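{- Let $G$ be a graph of order $n$ and let $D_n$ be a maximal Diophantine graph of order $n$. If $G$ is Diophantine, then $\alpha(G)\ge\alpha(D_n)$.
   Context: All graphs are finite, simple and undirected. A graph $G$ with $n$ vertices is Diophantine if there is a bijection $f:V(G)\to\{1,\dots,n\}$ such that $\gcd(f(u),f(v))\mid n$ for every edge $uv$. A maximal Diophantine graph $D_n$ of order $n$ is a Diophantine graph of order $n$ such that adding any new edge yields a non-Diophantine graph. $\alpha(H)$ is the independence number of a graph $H$. -}

module Defs where

open import Data.Nat using (ℕ; suc; _≤_)
open import Data.Nat.Divisibility using (_∣_)
open import Data.Nat.GCD using (gcd)
open import Data.Fin using (Fin; toℕ)
open import Data.Fin.Subset using (Subset; _∈_; ∣_∣)
open import Data.Bool using (Bool; true; false)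
open import Data.Product using (Σ; _×_; _,_)
open import Relation.Binary.PropositionalEquality using (_≡_)
open import Relation.Nullary using (¬_)
open import Function.Definitions using (Bijective)
open import Function.Bundles using (_⇔_)
open import Data.Sum using (_⊎_)

record Graph (n : ℕ) : Set where
  field
    adj   : Fin n → Fin n → Bool
    sym   : ∀ u v → adj u v ≡ adj v u
    irref : ∀ u → adj u u ≡ false
open Graph public

-- The label of vertex u under f : Fin n → Fin n is toℕ (f u) + 1 ∈ {1,…,n}.
label : {n : ℕ} → (Fin n → Fin n) → Fin n → ℕ
label f u = suc (toℕ (f u))

IsDiophantineLabeling : {n : ℕ} → Graph n → (Fin n → Fin n) → Set
IsDiophantineLabeling {n} G f =
  Bijective _≡_ _≡_ f ×
  (∀ u v → adj G u v ≡ true → gcd (label f u) (label f v) ∣ n)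

Diophantine : {n : ℕ} → Graph n → Set
Diophantine {n} G = Σ (Fin n → Fin n) λ f → IsDiophantineLabeling G f

IsAddEdge : {n : ℕ} → Graph n → Fin n → Fin n → Graph n → Set
IsAddEdge G u v H =
  ∀ x y → (adj H x y ≡ true) ⇔
          (adj G x y ≡ true ⊎ ((x ≡ u × y ≡ v) ⊎ (x ≡ v × y ≡ u)))

MaximalDiophantine : {n : ℕ} → Graph n → Set
MaximalDiophantine {n} G =
  Diophantine G ×
  (∀ (u v : Fin n) → ¬ (u ≡ v) → adj G u v ≡ false →
     ∀ (H : Graph n) → IsAddEdge G u v H → ¬ Diophantine H)

Independent : {n : ℕ} → Graph n → Subset n → Set
Independent G S = ∀ u v → u ∈ S → v ∈ S → adj G u v ≡ false

IsIndependenceNumber : {n : ℕ} → Graph n → ℕ → Set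
IsIndependenceNumber {n} G k =
  (Σ (Subset n) λ S → Independent G S × ∣ S ∣ ≡ k) ×
  (∀ (S : Subset n) → Independent G S → ∣ S ∣ ≤ k)

{-# OPTIONS --safe #-}
module Submission where

-- Let g be a Diophantine labeling of the maximal graph Dₙ and f one of G,
-- and send each vertex of G to the vertex of Dₙ carrying the same label.
-- If two distinct vertices of Dₙ are non-adjacent, their labels have a gcd
-- not dividing n (otherwise g would still label Dₙ plus that edge), so they
-- cannot be the images of adjacent vertices of G.  Hence this bijection is a
-- graph homomorphism G → Dₙ, and it pulls every independent set of Dₙ back
-- to an independent set of G of the same size.

open import Defs renaming (sym to adj-sym)
open import Data.Nat using (ℕ; suc; _≥_)
open import Data.Nat.Properties using (+-0-commutativeMonoid; module ≤-Reasoning)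
open import Data.Nat.GCD using (gcd; gcd-comm)
open import Data.Nat.Divisibility using (_∣_)
open import Data.Fin using (Fin; toℕ; _≟_)
open import Data.Fin.Subset using (Subset; _∈_; ∣_∣)
open import Data.Fin.Permutation using (Permutation; _⟨$⟩ʳ_; _∘ₚ_; flip; inverseʳ)
open import Data.Bool using (Bool; true; false; _∧_; _∨_)
open import Data.Bool.Properties using (∧-comm; ∨-comm; ¬-not)
open import Data.Vec using ([]; _∷_; lookup; tabulate)
open import Data.Vec.Properties using (lookup∘tabulate; []=⇒lookup; lookup⇒[]=)
open import Data.Product using (_×_; _,_; proj₁)
open import Data.Sum using (_⊎_; inj₁; inj₂)
open import Function.Base using (_∘_)
open import Function.Bundles using (_⇔_; mk⇔; mk⤖; module Equivalence)
open import Function.Definitions using (Bijective)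
open import Function.Properties.Bijection using (⤖⇒↔)
open import Relation.Binary.PropositionalEquality
  using (_≡_; _≢_; refl; sym; trans; cong; cong₂; subst; subst₂; module ≡-Reasoning)
open import Relation.Nullary using (Dec; yes; no; does; contradiction)
open import Relation.Nullary.Decidable using (_×-dec_; _⊎-dec_)
open import Algebra.Properties.CommutativeMonoid.Sum +-0-commutativeMonoid
  using (sum; sum-cong-≗; sum-permute)

private
  variable
    m n a b : ℕ

Homomorphism : Graph m → Graph n → (Fin m → Fin n) → Set
Homomorphism G H k = ∀ x y → adj G x y ≡ true → adj H (k x) (k y) ≡ true

adj⇒≢ : (G : Graph n) {x y : Fin n} → adj G x y ≡ true → x ≢ y
adj⇒≢ G {x} e refl = contradiction (trans (sym e) (irref G x)) λ ()

preimage : (Fin m → Fin n) → Subset n → Subset m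
preimage k S = tabulate (lookup S ∘ k)

∈-preimage⁻ : (k : Fin m → Fin n) (S : Subset n) {x : Fin m} →
              x ∈ preimage k S → k x ∈ S
∈-preimage⁻ k S {x} x∈ =
  lookup⇒[]= (k x) S (trans (sym (lookup∘tabulate (lookup S ∘ k) x)) ([]=⇒lookup x∈))

independent-preimage : {G : Graph m} {H : Graph n} {k : Fin m → Fin n} {S : Subset n} →
                       Homomorphism G H k → Independent H S → Independent G (preimage k S)
independent-preimage {k = k} {S} hom S-ind x y x∈ y∈ = ¬-not λ xy →
  contradiction (trans (sym (hom x y xy)) (S-ind _ _ (∈-preimage⁻ k S x∈) (∈-preimage⁻ k S y∈)))
                λ ()

indicator : Bool → ℕ
indicator true  = 1
indicator false = 0

∣p∣≡sum : (p : Subset n) → ∣ p ∣ ≡ sum (indicator ∘ lookup p)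
∣p∣≡sum []          = refl
∣p∣≡sum (true ∷ p)  = cong suc (∣p∣≡sum p)
∣p∣≡sum (false ∷ p) = ∣p∣≡sum p

∣preimage∣ : (π : Permutation n n) (S : Subset n) → ∣ preimage (π ⟨$⟩ʳ_) S ∣ ≡ ∣ S ∣
∣preimage∣ {n} π S = begin
  ∣ preimage (π ⟨$⟩ʳ_) S ∣                  ≡⟨ ∣p∣≡sum (preimage (π ⟨$⟩ʳ_) S) ⟩
  sum (indicator ∘ lookup (tabulate πS))    ≡⟨ sum-cong-≗ (cong indicator ∘ lookup∘tabulate πS) ⟩
  sum (indicator ∘ lookup S ∘ (π ⟨$⟩ʳ_))    ≡⟨ sum-permute (indicator ∘ lookup S) π ⟨
  sum (indicator ∘ lookup S)                ≡⟨ ∣p∣≡sum S ⟨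
  ∣ S ∣                                     ∎
  where
  open ≡-Reasoning
  πS : Fin n → Bool
  πS = lookup S ∘ (π ⟨$⟩ʳ_)

independenceNumber-antitone : {G H : Graph n} (π : Permutation n n) →
                              Homomorphism G H (π ⟨$⟩ʳ_) →
                              IsIndependenceNumber G a → IsIndependenceNumber H b → a ≥ b
independenceNumber-antitone {a = a} {b = b} {G = G} {H = H} π hom
                            (_ , G-max) ((S , S-ind , ∣S∣≡b) , _) = begin
  b                        ≡⟨ ∣S∣≡b ⟨
  ∣ S ∣                    ≡⟨ ∣preimage∣ π S ⟨
  ∣ preimage (π ⟨$⟩ʳ_) S ∣ ≤⟨ G-max _ (independent-preimage {G = G} {H = H} hom S-ind) ⟩
  a                        ∎
  where open ≤-Reasoning

IsEdgeBetween : Fin n → Fin n → Fin n → Fin n → Set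
IsEdgeBetween u v x y = (x ≡ u × y ≡ v) ⊎ (x ≡ v × y ≡ u)

isEdgeBetween? : (u v x y : Fin n) → Dec (IsEdgeBetween u v x y)
isEdgeBetween? u v x y = (x ≟ u ×-dec y ≟ v) ⊎-dec (x ≟ v ×-dec y ≟ u)

edgeBetween : Fin n → Fin n → Fin n → Fin n → Bool
edgeBetween u v x y = does (isEdgeBetween? u v x y)

does≡true⇔ : {A : Set} (A? : Dec A) → does A? ≡ true ⇔ A
does≡true⇔ (yes a) = mk⇔ (λ _ → a) (λ _ → refl)
does≡true⇔ (no ¬a) = mk⇔ (λ ()) (λ a → contradiction a ¬a)

addEdge : (G : Graph n) {u v : Fin n} → u ≢ v → Graph n
addEdge G {u} {v} u≢v = record
  { adj   = λ x y → adj G x y ∨ edgeBetween u v x y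
  ; sym   = λ x y → cong₂ _∨_ (adj-sym G x y) (edgeBetween-sym x y)
  ; irref = λ x → cong₂ _∨_ (irref G x) (edgeBetween-irref x)
  }
  where
  edgeBetween-sym : ∀ x y → edgeBetween u v x y ≡ edgeBetween u v y x
  edgeBetween-sym x y = trans (∨-comm (does (x ≟ u) ∧ does (y ≟ v)) _)
    (cong₂ _∨_ (∧-comm (does (x ≟ v)) _) (∧-comm (does (x ≟ u)) _))
  edgeBetween-irref : ∀ x → edgeBetween u v x x ≡ false
  edgeBetween-irref x = ¬-not λ e → u≢v (loop⇒u≡v (Equivalence.to (does≡true⇔ (isEdgeBetween? u v x x)) e))
    where
    loop⇒u≡v : IsEdgeBetween u v x x → u ≡ v
    loop⇒u≡v (inj₁ (refl , refl)) = refl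
    loop⇒u≡v (inj₂ (refl , refl)) = refl

addEdge-isAddEdge : (G : Graph n) {u v : Fin n} (u≢v : u ≢ v) → IsAddEdge G u v (addEdge G u≢v)
addEdge-isAddEdge G {u} {v} u≢v x y = mk⇔ to from
  where
  edge⇔ : edgeBetween u v x y ≡ true ⇔ IsEdgeBetween u v x y
  edge⇔ = does≡true⇔ (isEdgeBetween? u v x y)
  to : adj G x y ∨ edgeBetween u v x y ≡ true → adj G x y ≡ true ⊎ IsEdgeBetween u v x y
  to e with adj G x y
  ... | true  = inj₁ refl
  ... | false = inj₂ (Equivalence.to edge⇔ e)
  from : adj G x y ≡ true ⊎ IsEdgeBetween u v x y → adj G x y ∨ edgeBetween u v x y ≡ true
  from (inj₁ e) rewrite e = refl
  from (inj₂ uv) rewrite Equivalence.from edge⇔ uv = ∨-comm (adj G x y) true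

labeling-addEdge : {G H : Graph n} {u v : Fin n} {g : Fin n → Fin n} →
                   IsAddEdge G u v H → IsDiophantineLabeling G g →
                   gcd (label g u) (label g v) ∣ n → IsDiophantineLabeling H g
labeling-addEdge {n = n} {H = H} {g = g} H≡G+uv (g-bij , g-dio) gcd∣n = g-bij , H-dio
  where
  H-dio : ∀ x y → adj H x y ≡ true → gcd (label g x) (label g y) ∣ n
  H-dio x y e with Equivalence.to (H≡G+uv x y) e
  ... | inj₁ xy                    = g-dio x y xy
  ... | inj₂ (inj₁ (refl , refl)) = gcd∣n
  ... | inj₂ (inj₂ (refl , refl)) = subst (_∣ n) (gcd-comm (label g y) (label g x)) gcd∣n

maximalDiophantine-adj : {D : Graph n} {g : Fin n → Fin n} →
                         MaximalDiophantine D → IsDiophantineLabeling D g →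
                         {u v : Fin n} → u ≢ v → gcd (label g u) (label g v) ∣ n →
                         adj D u v ≡ true
maximalDiophantine-adj {n} {D} {g} (_ , D-max) g-lab {u} {v} u≢v gcd∣n = ¬-not λ uv-nonadj →
  D-max u v u≢v uv-nonadj D+uv D+uv-isAddEdge
    (g , labeling-addEdge {G = D} {H = D+uv} D+uv-isAddEdge g-lab gcd∣n)
  where
  D+uv : Graph n
  D+uv = addEdge D u≢v
  D+uv-isAddEdge : IsAddEdge D u v D+uv
  D+uv-isAddEdge = addEdge-isAddEdge D u≢v

labelPreserving-homomorphism : {G D : Graph n} {f g k : Fin n → Fin n} →
                               MaximalDiophantine D →
                               IsDiophantineLabeling G f → IsDiophantineLabeling D g →
                               (∀ w → g (k w) ≡ f w) → Homomorphism G D k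
labelPreserving-homomorphism {n} {G} {D} {f} {g} {k} D-max ((f-inj , _) , f-dio) g-lab g∘k≗f
                             x y xy =
  maximalDiophantine-adj {D = D} D-max g-lab kx≢ky gcd∣n
  where
  kx≢ky : k x ≢ k y
  kx≢ky kx≡ky = adj⇒≢ G xy (f-inj (trans (sym (g∘k≗f x)) (trans (cong g kx≡ky) (g∘k≗f y))))
  same-label : ∀ w → label f w ≡ label g (k w)
  same-label w = cong (suc ∘ toℕ) (sym (g∘k≗f w))
  gcd∣n : gcd (label g (k x)) (label g (k y)) ∣ n
  gcd∣n = subst₂ (λ i j → gcd i j ∣ n) (same-label x) (same-label y) (f-dio x y xy)

toPermutation : {f : Fin n → Fin n} → Bijective _≡_ _≡_ f → Permutation n n
toPermutation {f = f} f-bij = ⤖⇒↔ (mk⤖ {to = f} f-bij)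

corollary3p9 : (n : ℕ) (G Dn : Graph n) → MaximalDiophantine Dn → Diophantine G →
    (a b : ℕ) → IsIndependenceNumber G a → IsIndependenceNumber Dn b → a ≥ b
corollary3p9 n G Dn Dn-max@((g , g-lab) , _) (f , f-lab) a b αG αDn =
  independenceNumber-antitone {G = G} {H = Dn} matchLabels
    (labelPreserving-homomorphism {G = G} {D = Dn} {f = f} {g = g} Dn-max f-lab g-lab (λ _ → inverseʳ gₚ))
    αG αDn
  where
  gₚ : Permutation n n
  gₚ = toPermutation (proj₁ g-lab)
  matchLabels : Permutation n n
  matchLabels = toPermutation (proj₁ f-lab) ∘ₚ flip gₚ
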